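{- Let $n_1,n_2,n_3\ge 2$, let $h,h'\in\{0,\dots,n_3-1\}$ with $h\ne h'$, $i\in\{0,\dots,n_1-1\}$ and $j\in\{0,\dots,n_2-1\}$. Then $S=\{(0,0,h),(n_1-1,0,h),(0,n_2-1,h),(i,j,h')\}$ is a resolving set for $P_{n_1}\Box P_{n_2}\Box P_{n_3}$.
   Context: $P_{n_1}\Box P_{n_2}\Box P_{n_3}$ is the grid graph with vertex set $\{(x_1,x_2,x_3): 0\le x_i\le n_i-1\}$, two vertices adjacent iff they differ by exactly $1$ in exactly one coordinate; $d(x,y)=\sum_i|x_i-y_i|$. A set $S$ of vertices is resolving if for every pair of distinct vertices $x,y$ there is $w\in S$ with $d(w,x)\ne d(w,y)$. -}

module Defs where

open import Data.Nat using (ℕ; _+_; ∣_-_∣)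
open import Data.Fin using (Fin; toℕ)
open import Data.Product using (_×_; _,_; ∃-syntax)
open import Data.List using (List)
open import Data.List.Membership.Propositional using (_∈_)
open import Relation.Binary.PropositionalEquality using (_≡_)
open import Relation.Nullary using (¬_)

Vertex : ℕ → ℕ → ℕ → Set
Vertex n₁ n₂ n₃ = Fin n₁ × Fin n₂ × Fin n₃

dist : ∀ {n₁ n₂ n₃} → Vertex n₁ n₂ n₃ → Vertex n₁ n₂ n₃ → ℕ
dist (x₁ , x₂ , x₃) (y₁ , y₂ , y₃) =
  ∣ toℕ x₁ - toℕ y₁ ∣ + ∣ toℕ x₂ - toℕ y₂ ∣ + ∣ toℕ x₃ - toℕ y₃ ∣

Resolving : ∀ n₁ n₂ n₃ → List (Vertex n₁ n₂ n₃) → Set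
Resolving n₁ n₂ n₃ S =
  (x y : Vertex n₁ n₂ n₃) → ¬ (x ≡ y) → ∃[ w ] (w ∈ S × ¬ (dist w x ≡ dist w y))

-- The landmarks (0,0,h) and (n₁-1,0,h) measure x₁ from both ends of P_{n₁}, each plus
-- the same remainder x₂ + |h - x₃|, so together they determine x₁ and that remainder;
-- (0,n₂-1,h) then does the same for x₂ and |h - x₃|. Knowing |h - x₃| leaves at most
-- x₃ and its mirror image 2h - x₃, and the landmark at the other height h' separates
-- these, since reflections in two distinct centres never agree.
module Submission where

open import Defs
open import Data.Nat using (ℕ; suc; _≤_; _<_; _+_; _∸_; ∣_-_∣; _≟_)
open import Data.Nat.Properties
open import Data.Fin using (Fin; zero; fromℕ; toℕ)
open import Data.Fin.Properties using (toℕ-injective; toℕ-fromℕ; toℕ≤pred[n])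
open import Data.Product using (_,_; _×_; proj₁; proj₂)
open import Data.Sum using (_⊎_; inj₁; inj₂)
open import Data.List using (List; _∷_; [])
open import Data.List.Relation.Unary.All using (All; _∷_; []; all?)
open import Data.List.Relation.Unary.All.Properties using (¬All⇒Any¬)
open import Data.List.Membership.Propositional using (find)
open import Data.Empty using (⊥-elim)
open import Function using (_∘_)
open import Relation.Binary.Definitions using (tri<; tri≈; tri>)
open import Relation.Binary.PropositionalEquality
open import Relation.Nullary using (¬_; yes; no)

resolving-if-distances-determine : ∀ {n₁ n₂ n₃} (S : List (Vertex n₁ n₂ n₃)) →
  (∀ x y → All (λ w → dist w x ≡ dist w y) S → x ≡ y) → Resolving n₁ n₂ n₃ S
resolving-if-distances-determine S determine x y x≢y
  with all? (λ w → dist w x ≟ dist w y) S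
... | yes equal = ⊥-elim (x≢y (determine x y equal))
... | no ¬equal = find (¬All⇒Any¬ (λ w → dist w x ≟ dist w y) S ¬equal)

m+m-injective : ∀ {m n} → m + m ≡ n + n → m ≡ n
m+m-injective {m} {n} eq with <-cmp m n
... | tri< m<n _ _ = ⊥-elim (<-irrefl eq (+-mono-< m<n m<n))
... | tri≈ _ m≡n _ = m≡n
... | tri> _ _ n<m = ⊥-elim (<-irrefl (sym eq) (+-mono-< n<m n<m))

module _ {m : ℕ} where

  private
    from-both-ends-< : ∀ {p q r s} → p < q → q ≤ m → p + r ≡ q + s →
      (m ∸ q) + s < (m ∸ p) + r
    from-both-ends-< {p} {q} {r} {s} p<q q≤m eq = +-mono-< (∸-monoʳ-< p<q q≤m) s<r
      where
      s<r : s < r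
      s<r = +-cancelˡ-< p s r (subst (p + s <_) (sym eq) (+-monoˡ-< s p<q))

  from-both-ends-injective : ∀ {p q r s} → p ≤ m → q ≤ m →
    p + r ≡ q + s → (m ∸ p) + r ≡ (m ∸ q) + s → p ≡ q × r ≡ s
  from-both-ends-injective {p} {q} {r} {s} p≤m q≤m eq₀ eqₘ with <-cmp p q
  ... | tri< p<q _ _ = ⊥-elim (<-irrefl (sym eqₘ) (from-both-ends-< p<q q≤m eq₀))
  ... | tri≈ _ refl _ = refl , +-cancelˡ-≡ p r s eq₀
  ... | tri> _ _ q<p = ⊥-elim (<-irrefl eqₘ (from-both-ends-< q<p p≤m (sym eq₀)))

m≤n⇒m+∣n-m∣≡n : ∀ {m n} → m ≤ n → m + ∣ n - m ∣ ≡ n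
m≤n⇒m+∣n-m∣≡n {m} m≤n = trans (cong (m +_) (m≤n⇒∣n-m∣≡n∸m m≤n)) (m+[n∸m]≡n m≤n)

m≤n⇒m+∣m-n∣≡n : ∀ {m n} → m ≤ n → m + ∣ m - n ∣ ≡ n
m≤n⇒m+∣m-n∣≡n {m} m≤n = trans (cong (m +_) (m≤n⇒∣m-n∣≡n∸m m≤n)) (m+[n∸m]≡n m≤n)

equidistant-opposite-sides : ∀ {h c c'} → c ≤ h → h ≤ c' →
  ∣ h - c ∣ ≡ ∣ h - c' ∣ → c + c' ≡ h + h
equidistant-opposite-sides {h} {c} {c'} c≤h h≤c' eq = begin
  c + c'                 ≡⟨ cong (c +_) (m≤n⇒m+∣m-n∣≡n h≤c') ⟨
  c + (h + ∣ h - c' ∣)   ≡⟨ cong (λ d → c + (h + d)) eq ⟨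
  c + (h + ∣ h - c ∣)    ≡⟨ +-assoc c h _ ⟨
  c + h + ∣ h - c ∣      ≡⟨ cong (_+ ∣ h - c ∣) (+-comm c h) ⟩
  h + c + ∣ h - c ∣      ≡⟨ +-assoc h c _ ⟩
  h + (c + ∣ h - c ∣)    ≡⟨ cong (h +_) (m≤n⇒m+∣n-m∣≡n c≤h) ⟩
  h + h                  ∎
  where open ≡-Reasoning

equidistant⇒equal-or-mirrored : ∀ h c c' →
  ∣ h - c ∣ ≡ ∣ h - c' ∣ → c ≡ c' ⊎ c + c' ≡ h + h
equidistant⇒equal-or-mirrored h c c' eq with ≤-total c h | ≤-total c' h
... | inj₁ c≤h | inj₁ c'≤h = inj₁ (+-cancelˡ-≡ ∣ h - c ∣ c c' (begin
  ∣ h - c ∣ + c   ≡⟨ +-comm _ c ⟩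
  c + ∣ h - c ∣   ≡⟨ m≤n⇒m+∣n-m∣≡n c≤h ⟩
  h               ≡⟨ m≤n⇒m+∣n-m∣≡n c'≤h ⟨
  c' + ∣ h - c' ∣ ≡⟨ cong (c' +_) eq ⟨
  c' + ∣ h - c ∣  ≡⟨ +-comm c' _ ⟩
  ∣ h - c ∣ + c'  ∎))
  where open ≡-Reasoning
... | inj₁ c≤h | inj₂ h≤c' = inj₂ (equidistant-opposite-sides c≤h h≤c' eq)
... | inj₂ h≤c | inj₁ c'≤h =
  inj₂ (trans (+-comm c c') (equidistant-opposite-sides c'≤h h≤c (sym eq)))
... | inj₂ h≤c | inj₂ h≤c' =
  inj₁ (trans (sym (m≤n⇒m+∣m-n∣≡n h≤c)) (trans (cong (h +_) eq) (m≤n⇒m+∣m-n∣≡n h≤c')))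

equidistant-from-two-centres⇒equal : ∀ {h h' c c'} → h ≢ h' →
  ∣ h - c ∣ ≡ ∣ h - c' ∣ → ∣ h' - c ∣ ≡ ∣ h' - c' ∣ → c ≡ c'
equidistant-from-two-centres⇒equal {h} {h'} {c} {c'} h≢h' eq eq'
  with equidistant⇒equal-or-mirrored h c c' eq | equidistant⇒equal-or-mirrored h' c c' eq'
... | inj₁ c≡c' | _ = c≡c'
... | inj₂ _ | inj₁ c≡c' = c≡c'
... | inj₂ mirror | inj₂ mirror' = ⊥-elim (h≢h' (m+m-injective (trans (sym mirror) mirror')))

∣fromℕ-toℕ∣≡∸ : ∀ {m} (a : Fin (suc m)) → ∣ toℕ (fromℕ m) - toℕ a ∣ ≡ m ∸ toℕ a
∣fromℕ-toℕ∣≡∸ {m} a rewrite toℕ-fromℕ m = m≤n⇒∣n-m∣≡n∸m (toℕ≤pred[n] a)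

module Landmarks {m₁ m₂ m₃ : ℕ} (h : Fin (suc m₃)) where

  Point : Set
  Point = Vertex (suc m₁) (suc m₂) (suc m₃)

  height : Fin (suc m₃) → ℕ
  height c = ∣ toℕ h - toℕ c ∣

  dist-origin : ∀ (a : Fin (suc m₁)) (b : Fin (suc m₂)) c →
    dist (zero , zero , h) (a , b , c) ≡ toℕ a + (toℕ b + height c)
  dist-origin a b c = +-assoc (toℕ a) (toℕ b) (height c)

  dist-corner₁ : ∀ (a : Fin (suc m₁)) (b : Fin (suc m₂)) c →
    dist (fromℕ m₁ , zero , h) (a , b , c) ≡ (m₁ ∸ toℕ a) + (toℕ b + height c)
  dist-corner₁ a b c = begin
    ∣ toℕ (fromℕ m₁) - toℕ a ∣ + toℕ b + height c ≡⟨ cong (λ d → d + toℕ b + height c) (∣fromℕ-toℕ∣≡∸ a) ⟩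
    (m₁ ∸ toℕ a) + toℕ b + height c             ≡⟨ +-assoc (m₁ ∸ toℕ a) (toℕ b) (height c) ⟩
    (m₁ ∸ toℕ a) + (toℕ b + height c)           ∎
    where open ≡-Reasoning

  dist-corner₂ : ∀ (a : Fin (suc m₁)) (b : Fin (suc m₂)) c →
    dist (zero , fromℕ m₂ , h) (a , b , c) ≡ toℕ a + ((m₂ ∸ toℕ b) + height c)
  dist-corner₂ a b c = begin
    toℕ a + ∣ toℕ (fromℕ m₂) - toℕ b ∣ + height c ≡⟨ cong (λ d → toℕ a + d + height c) (∣fromℕ-toℕ∣≡∸ b) ⟩
    toℕ a + (m₂ ∸ toℕ b) + height c             ≡⟨ +-assoc (toℕ a) (m₂ ∸ toℕ b) (height c) ⟩
    toℕ a + ((m₂ ∸ toℕ b) + height c)           ∎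
    where open ≡-Reasoning

  planar-landmarks-determine : ∀ (a a' : Fin (suc m₁)) (b b' : Fin (suc m₂)) c c' →
    let x = (a , b , c) ; y = (a' , b' , c') in
    dist (zero , zero , h) x ≡ dist (zero , zero , h) y →
    dist (fromℕ m₁ , zero , h) x ≡ dist (fromℕ m₁ , zero , h) y →
    dist (zero , fromℕ m₂ , h) x ≡ dist (zero , fromℕ m₂ , h) y →
    a ≡ a' × b ≡ b' × height c ≡ height c'
  planar-landmarks-determine a a' b b' c c' e₀ e₁ e₂ =
    toℕ-injective a≡a' , toℕ-injective (proj₁ by-b) , proj₂ by-b
    where
    by-a : toℕ a ≡ toℕ a' × toℕ b + height c ≡ toℕ b' + height c'
    by-a = from-both-ends-injective (toℕ≤pred[n] a) (toℕ≤pred[n] a')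
      (subst₂ _≡_ (dist-origin a b c) (dist-origin a' b' c') e₀)
      (subst₂ _≡_ (dist-corner₁ a b c) (dist-corner₁ a' b' c') e₁)

    a≡a' = proj₁ by-a

    by-b : toℕ b ≡ toℕ b' × height c ≡ height c'
    by-b = from-both-ends-injective (toℕ≤pred[n] b) (toℕ≤pred[n] b') (proj₂ by-a)
      (+-cancelˡ-≡ (toℕ a) _ _ (subst₂ _≡_ (dist-corner₂ a b c)
        (trans (dist-corner₂ a' b' c') (cong (_+ _) (sym a≡a'))) e₂))

  landmarks-determine : ∀ {h'} → h ≢ h' → ∀ i j → (x y : Point) →
    All (λ w → dist w x ≡ dist w y)
      ((zero , zero , h) ∷ (fromℕ m₁ , zero , h) ∷ (zero , fromℕ m₂ , h) ∷ (i , j , h') ∷ []) →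
    x ≡ y
  landmarks-determine h≢h' i j (a , b , c) (a' , b' , c') (e₀ ∷ e₁ ∷ e₂ ∷ e₃ ∷ [])
    with planar-landmarks-determine a a' b b' c c' e₀ e₁ e₂
  ... | refl , refl , same-height = cong (λ z → a , b , z) (toℕ-injective
    (equidistant-from-two-centres⇒equal (h≢h' ∘ toℕ-injective) same-height (+-cancelˡ-≡ _ _ _ e₃)))

lemma3 : (m₁ m₂ m₃ : ℕ) → 1 ≤ m₁ → 1 ≤ m₂ → 1 ≤ m₃ →
    (h h' : Fin (suc m₃)) → ¬ (h ≡ h') →
    (i : Fin (suc m₁)) → (j : Fin (suc m₂)) →
    Resolving (suc m₁) (suc m₂) (suc m₃)
      ((zero , zero , h) ∷ (fromℕ m₁ , zero , h) ∷ (zero , fromℕ m₂ , h) ∷ (i , j , h') ∷ [])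
lemma3 m₁ m₂ m₃ _ _ _ h h' h≢h' i j =
  resolving-if-distances-determine _ (Landmarks.landmarks-determine h h≢h' i j)
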